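{- Let $K$ be a variety of Boolean algebras with operators having finitely many extra-Boolean operations. Assume: (i) for every $\mathfrak{B}\in K$ and every $b'\in B$ there exists $b\in B$ with $\mathrm{Ig}^{\mathfrak{B}}\{b'\}=\mathrm{Ig}^{\mathrm{Bl}\,\mathfrak{B}}\{b\}$; and (ii) whenever $b_0',b_1'\in B$ form a partition of the unit (i.e. $b_0'\cdot b_1'=0$ and $b_0'+b_1'=1$), elements $b_0,b_1$ as in (i) with $\mathrm{Ig}^{\mathfrak{B}}\{b_i'\}=\mathrm{Ig}^{\mathrm{Bl}\,\mathfrak{B}}\{b_i\}$ ($i=0,1$) can be chosen so that they also form a partition of the unit. Then for every cardinal $\beta$, $\mathrm{Fr}_{\beta}K\times\mathrm{Fr}_{\beta}K\cong\mathrm{Fr}_{|\beta+1|}K$. In particular, if $\beta$ is infinite and $\mathfrak{A}=\mathrm{Fr}_{\beta}K$, then $\mathfrak{A}\times\mathfrak{A}\cong\mathfrak{A}$.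
   Context: $\mathrm{Fr}_\beta K$ is the free $K$-algebra on $\beta$ generators. For $\mathfrak{B}\in K$, $\mathrm{Ig}^{\mathfrak{B}}\{b'\}$ is the ideal of $\mathfrak{B}$ generated by $b'$ in the BAO sense (Boolean ideals closed under the extra operations, corresponding to congruences), $\mathrm{Bl}\,\mathfrak{B}$ is the Boolean reduct, and $\mathrm{Ig}^{\mathrm{Bl}\,\mathfrak{B}}\{b\}=\{x: x\le b\}$. -}

module Defs where

open import Level using (Level; 0ℓ) renaming (suc to lsuc)
open import Data.Nat using (ℕ)
open import Data.Fin using (Fin)
import Data.Product
open import Data.Product using (_×_; _,_; ∃; ∃-syntax)
open import Data.Vec.Functional using (updateAt)
open import Function using (const)
open import Relation.Binary using (Rel)
open import Algebra.Lattice.Bundles using (BooleanAlgebra)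

record Signature : Set where
  field
    n  : ℕ
    ar : Fin n → ℕ

module _ (Σ' : Signature) where
  open Signature Σ'

  data Term (X : Set) : Set where
    var  : X → Term X
    top  : Term X
    bot  : Term X
    meet : Term X → Term X → Term X
    join : Term X → Term X → Term X
    neg  : Term X → Term X
    op   : (i : Fin n) → (Fin (ar i) → Term X) → Term X

  record BAO : Set₁ where
    field
      boolAlg : BooleanAlgebra 0ℓ 0ℓ
    open BooleanAlgebra boolAlg public
    field
      ops      : (i : Fin n) → (Fin (ar i) → Carrier) → Carrier
      ops-cong : ∀ i (a b : Fin (ar i) → Carrier) →
                 (∀ j → a j ≈ b j) → ops i a ≈ ops i b
      ops-normal : ∀ i (a : Fin (ar i) → Carrier) j →
                   ops i (updateAt a j (const ⊥)) ≈ ⊥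
      ops-additive : ∀ i (a : Fin (ar i) → Carrier) j x y →
                     ops i (updateAt a j (const (x ∨ y)))
                       ≈ (ops i (updateAt a j (const x)) ∨ ops i (updateAt a j (const y)))

    _≤_ : Carrier → Carrier → Set
    x ≤ y = (x ∧ y) ≈ x

    eval : ∀ {X : Set} → (X → Carrier) → Term X → Carrier
    eval ρ (var x)    = ρ x
    eval ρ top        = ⊤
    eval ρ bot        = ⊥
    eval ρ (meet s t) = eval ρ s ∧ eval ρ t
    eval ρ (join s t) = eval ρ s ∨ eval ρ t
    eval ρ (neg s)    = ¬ eval ρ s
    eval ρ (op i ts)  = ops i (λ j → eval ρ (ts j))

    data Ig (b' : Carrier) : Carrier → Set where
      gen   : Ig b' b'
      zero  : Ig b' ⊥
      ∨-cl  : ∀ {x y} → Ig b' x → Ig b' y → Ig b' (x ∨ y)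
      ↓-cl  : ∀ {x y} → x ≤ y → Ig b' y → Ig b' x
      ops-cl : ∀ i (a : Fin (ar i) → Carrier) j → Ig b' (a j) → Ig b' (ops i a)

    -- Ig^{𝔅}{b'} = Ig^{Bl 𝔅}{b}  (the latter being {x : x ≤ b})
    IgEqBl : Carrier → Carrier → Set
    IgEqBl b' b = ∀ x → (Ig b' x → x ≤ b) × (x ≤ b → Ig b' x)

  Equation : Set
  Equation = Term ℕ × Term ℕ

  -- A variety K of BAOs is given by a set E of equations;
  -- 𝔅 ∈ K means 𝔅 satisfies every equation of E.
  _∈V_ : BAO → (Equation → Set) → Set
  B ∈V E = ∀ s t → E (s , t) → ∀ (ρ : ℕ → BAO.Carrier B) →
             BAO._≈_ B (BAO.eval B ρ s) (BAO.eval B ρ t)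

  record RawBAO ℓ : Set (lsuc ℓ) where
    field
      Carrier : Set ℓ
      _≈_     : Rel Carrier ℓ
      ⊤ᵣ ⊥ᵣ   : Carrier
      _∧ᵣ_ _∨ᵣ_ : Carrier → Carrier → Carrier
      ¬ᵣ_     : Carrier → Carrier
      opsᵣ    : (i : Fin n) → (Fin (ar i) → Carrier) → Carrier

  Fr : (Equation → Set) → (X : Set) → RawBAO (lsuc 0ℓ)
  Fr E X = record
    { Carrier = Level.Lift (lsuc 0ℓ) (Term X)
    ; _≈_ = λ s t → ∀ (B : BAO) → B ∈V E → ∀ (ρ : X → BAO.Carrier B) →
                    BAO._≈_ B (BAO.eval B ρ (Level.lower s)) (BAO.eval B ρ (Level.lower t))
    ; ⊤ᵣ = Level.lift top
    ; ⊥ᵣ = Level.lift bot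
    ; _∧ᵣ_ = λ s t → Level.lift (meet (Level.lower s) (Level.lower t))
    ; _∨ᵣ_ = λ s t → Level.lift (join (Level.lower s) (Level.lower t))
    ; ¬ᵣ_ = λ s → Level.lift (neg (Level.lower s))
    ; opsᵣ = λ i ts → Level.lift (op i (λ j → Level.lower (ts j)))
    }

  _×ᴮ_ : ∀ {ℓ} → RawBAO ℓ → RawBAO ℓ → RawBAO ℓ
  A ×ᴮ B = record
    { Carrier = A.Carrier × B.Carrier
    ; _≈_ = λ { (a , b) (a' , b') → A._≈_ a a' × B._≈_ b b' }
    ; ⊤ᵣ = A.⊤ᵣ , B.⊤ᵣ
    ; ⊥ᵣ = A.⊥ᵣ , B.⊥ᵣ
    ; _∧ᵣ_ = λ { (a , b) (a' , b') → A._∧ᵣ_ a a' , B._∧ᵣ_ b b' }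
    ; _∨ᵣ_ = λ { (a , b) (a' , b') → A._∨ᵣ_ a a' , B._∨ᵣ_ b b' }
    ; ¬ᵣ_ = λ { (a , b) → A.¬ᵣ_ a , B.¬ᵣ_ b }
    ; opsᵣ = λ i abs → A.opsᵣ i (λ j → Data.Product.proj₁ (abs j))
                     , B.opsᵣ i (λ j → Data.Product.proj₂ (abs j))
    }
    where module A = RawBAO A
          module B = RawBAO B

  record _≅_ {ℓ} (A B : RawBAO ℓ) : Set ℓ where
    private module A = RawBAO A
    private module B = RawBAO B
    field
      to        : A.Carrier → B.Carrier
      from      : B.Carrier → A.Carrier
      to-cong   : ∀ {x y} → A._≈_ x y → B._≈_ (to x) (to y)
      from-cong : ∀ {x y} → B._≈_ x y → A._≈_ (from x) (from y)
      to-from   : ∀ y → B._≈_ (to (from y)) y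
      from-to   : ∀ x → A._≈_ (from (to x)) x
      to-⊤ : B._≈_ (to A.⊤ᵣ) B.⊤ᵣ
      to-⊥ : B._≈_ (to A.⊥ᵣ) B.⊥ᵣ
      to-∧ : ∀ x y → B._≈_ (to (A._∧ᵣ_ x y)) (B._∧ᵣ_ (to x) (to y))
      to-∨ : ∀ x y → B._≈_ (to (A._∨ᵣ_ x y)) (B._∨ᵣ_ (to x) (to y))
      to-¬ : ∀ x → B._≈_ (to (A.¬ᵣ_ x)) (B.¬ᵣ_ (to x))
      to-ops : ∀ i (a : Fin (ar i) → A.Carrier) →
               B._≈_ (to (A.opsᵣ i a)) (B.opsᵣ i (λ j → to (a j)))

  HypI : (Equation → Set) → Set₁
  HypI E = ∀ (B : BAO) → B ∈V E → ∀ (b' : BAO.Carrier B) →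
           ∃[ b ] BAO.IgEqBl B b' b

  HypII : (Equation → Set) → Set₁
  HypII E = ∀ (B : BAO) → B ∈V E → ∀ (b₀' b₁' : BAO.Carrier B) →
            let open BAO B in
            (b₀' ∧ b₁') ≈ ⊥ → (b₀' ∨ b₁') ≈ ⊤ →
            ∃[ b₀ ] ∃[ b₁ ] (IgEqBl b₀' b₀ × IgEqBl b₁' b₁ ×
                             (b₀ ∧ b₁) ≈ ⊥ × (b₀ ∨ b₁) ≈ ⊤)

-- Write Y = X ⊎ {z} and apply (ii) in the free algebra on Y to the partition ¬z, z. It yields
-- a partition b₀, b₁ with Ig{¬z} = ↓b₀ and Ig{z} = ↓b₁, and the isomorphism is
-- (s, t) ↦ b₀·s + b₁·t with inverse q ↦ (q[z:=0], q[z:=1]). Every term q is congruent to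
-- q[z:=0] modulo Ig{z} = ↓b₁, which is disjoint from b₀, so b₀·q = b₀·q[z:=0]; symmetrically
-- b₁·q = b₁·q[z:=1], and b₀ + b₁ = 1 gives back q. Conversely, under any valuation in K with
-- z = 0 the element b₁ lands in Ig{0} = {0}, so b₀ = 1 and the pair is recovered.
module Submission where

open import Level using (lift; lower)
open import Algebra.Lattice.Bundles using (BooleanAlgebra)
import Algebra.Lattice.Properties.BooleanAlgebra as BooleanAlgebraProps
open import Data.Fin using (Fin; zero; suc)
open import Data.Nat using (ℕ; zero; suc)
open import Data.Product using (_×_; _,_; proj₁; proj₂)
open import Data.Sum using (_⊎_; inj₁; inj₂; [_,_]′)
import Data.Unit as Unit
open import Data.Vec.Functional using (updateAt; _∷_; tail)
open import Data.Vec.Functional.Properties using (updateAt-updates; map-updateAt-local)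
open import Function using (_∘_; const)
open import Function.Bundles using (_↔_; Inverse)
open import Function.Construct.Identity using (↔-id)
open import Relation.Binary using (IsEquivalence; Setoid; Preorder)
import Relation.Binary.Lattice as OrderLattice
import Relation.Binary.Lattice.Properties.MeetSemilattice as MeetSemilatticeProps
import Relation.Binary.Lattice.Properties.JoinSemilattice as JoinSemilatticeProps
open import Relation.Binary.PropositionalEquality as ≡ using (_≡_)
import Relation.Binary.Reasoning.PartialOrder as ≤-Reasoning
import Relation.Binary.Reasoning.Preorder as ≲-Reasoning
import Relation.Binary.Reasoning.Setoid as ≈-Reasoning

open import Defs

infixl 9 _[_]≔_
_[_]≔_ : ∀ {a} {A : Set a} {m} → (Fin m → A) → Fin m → A → Fin m → A
v [ j ]≔ u = updateAt v j (const u)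

module UpdateSetoid {c ℓ} (A : Setoid c ℓ) where
  open Setoid A

  []≔-cong : ∀ {m} (v : Fin m → Carrier) j {u u'} → u ≈ u' →
             ∀ k → (v [ j ]≔ u) k ≈ (v [ j ]≔ u') k
  []≔-cong v zero    u≈u' zero    = u≈u'
  []≔-cong v zero    u≈u' (suc k) = refl
  []≔-cong v (suc j) u≈u' zero    = refl
  []≔-cong v (suc j) u≈u' (suc k) = []≔-cong (tail v) j u≈u' k

  []≔-self : ∀ {m} (v : Fin m → Carrier) j → ∀ k → v k ≈ (v [ j ]≔ v j) k
  []≔-self v zero    zero    = refl
  []≔-self v zero    (suc k) = refl
  []≔-self v (suc j) zero    = refl
  []≔-self v (suc j) (suc k) = []≔-self (tail v) j k

module UpdatePreorder {c ℓ r} (P : Preorder c ℓ r) where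
  open Preorder P
  open ≲-Reasoning P

  coordinatewise⇒pointwise :
    ∀ {m} (F : (Fin m → Carrier) → Carrier) →
    (∀ {v w} → (∀ k → v k ≈ w k) → F v ≈ F w) →
    (∀ v j {u u'} → u ≲ u' → F (v [ j ]≔ u) ≲ F (v [ j ]≔ u')) →
    ∀ {v w} → (∀ k → v k ≲ w k) → F v ≲ F w
  coordinatewise⇒pointwise {zero} F F-cong F-coord v≲w = reflexive (F-cong λ ())
  coordinatewise⇒pointwise {suc m} F F-cong F-coord {v} {w} v≲w = begin
    F v                      ≈⟨ F-cong (λ { zero → Eq.refl ; (suc k) → Eq.refl }) ⟩
    F (v [ zero ]≔ v zero)   ≲⟨ F-coord v zero (v≲w zero) ⟩
    F (v [ zero ]≔ w zero)   ≈⟨ F-cong (λ { zero → Eq.refl ; (suc k) → Eq.refl }) ⟩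
    G (tail v)               ≲⟨ coordinatewise⇒pointwise G G-cong G-coord (v≲w ∘ suc) ⟩
    G (tail w)               ≈⟨ F-cong (λ { zero → Eq.refl ; (suc k) → Eq.refl }) ⟩
    F w                      ∎
    where
    G : (Fin m → Carrier) → Carrier
    G x = F (w zero ∷ x)
    G-cong : ∀ {x y} → (∀ k → x k ≈ y k) → G x ≈ G y
    G-cong x≈y = F-cong λ { zero → Eq.refl ; (suc k) → x≈y k }
    G-coord : ∀ x j {u u'} → u ≲ u' → G (x [ j ]≔ u) ≲ G (x [ j ]≔ u')
    G-coord x j {u} {u'} u≲u' = begin
      G (x [ j ]≔ u)                     ≈⟨ F-cong (λ { zero → Eq.refl ; (suc k) → Eq.refl }) ⟩
      F ((w zero ∷ x) [ suc j ]≔ u)      ≲⟨ F-coord (w zero ∷ x) (suc j) u≲u' ⟩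
      F ((w zero ∷ x) [ suc j ]≔ u')     ≈⟨ F-cong (λ { zero → Eq.refl ; (suc k) → Eq.refl }) ⟩
      G (x [ j ]≔ u')                    ∎

module BooleanAlgebraProperties {c ℓ} (𝔹 : BooleanAlgebra c ℓ) where
  open BooleanAlgebra 𝔹
  open BooleanAlgebraProps 𝔹 hiding (poset)
  open BooleanAlgebraProps 𝔹 public using (poset)
  open OrderLattice.Lattice ∨-∧-orderTheoreticLattice public
    using (_≤_; x∧y≤x; x∧y≤y; ∧-greatest; x≤x∨y)
    renaming (refl to ≤-refl; reflexive to ≤-reflexive; trans to ≤-trans; antisym to ≤-antisym)
  open OrderLattice.Lattice ∨-∧-orderTheoreticLattice
    using (meetSemilattice; joinSemilattice)
  open MeetSemilatticeProps meetSemilattice public using (∧-monotonic)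
  open JoinSemilatticeProps joinSemilattice public using (∨-monotonic; x≤y⇒x∨y≈y)
  open ≤-Reasoning poset

  infixl 8 _∖_
  _∖_ : Carrier → Carrier → Carrier
  x ∖ y = x ∧ ¬ y

  ≤⊥⇒≈⊥ : ∀ {x} → x ≤ ⊥ → x ≈ ⊥
  ≤⊥⇒≈⊥ {x} x≤⊥ = trans x≤⊥ (∧-zeroʳ x)

  ∧-∨-∖ : ∀ x y → x ≈ (x ∧ y) ∨ (x ∖ y)
  ∧-∨-∖ x y = begin-equality
    x                    ≈⟨ ∧-identityʳ x ⟨
    x ∧ ⊤                ≈⟨ ∧-congˡ (∨-complementʳ y) ⟨
    x ∧ (y ∨ ¬ y)        ≈⟨ ∧-distribˡ-∨ x y (¬ y) ⟩
    (x ∧ y) ∨ (x ∖ y)    ∎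

  x≤y∨z⇒x∖y≤z : ∀ {x y z} → x ≤ y ∨ z → x ∖ y ≤ z
  x≤y∨z⇒x∖y≤z {x} {y} {z} x≤y∨z = begin
    x ∖ y                  ≤⟨ ∧-monotonic x≤y∨z ≤-refl ⟩
    (y ∨ z) ∖ y            ≈⟨ ∧-distribʳ-∨ (¬ y) y z ⟩
    (y ∖ y) ∨ (z ∖ y)      ≈⟨ ∨-congʳ (∧-complementʳ y) ⟩
    ⊥ ∨ (z ∖ y)            ≈⟨ ∨-identityˡ _ ⟩
    z ∖ y                  ≤⟨ x∧y≤x z (¬ y) ⟩
    z                      ∎

  ∖-triangle : ∀ x y z → x ∖ z ≤ (x ∖ y) ∨ (y ∖ z)
  ∖-triangle x y z = begin
    x ∖ z                              ≈⟨ ∧-∨-∖ (x ∖ z) y ⟩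
    (x ∖ z ∧ y) ∨ (x ∖ z ∖ y)          ≤⟨ ∨-monotonic inside-y outside-y ⟩
    (y ∖ z) ∨ (x ∖ y)                  ≈⟨ ∨-comm _ _ ⟩
    (x ∖ y) ∨ (y ∖ z)                  ∎
    where
    inside-y : x ∖ z ∧ y ≤ y ∖ z
    inside-y = ∧-greatest (x∧y≤y _ _) (≤-trans (x∧y≤x _ _) (x∧y≤y _ _))
    outside-y : x ∖ z ∖ y ≤ x ∖ y
    outside-y = ∧-monotonic (x∧y≤x _ _) ≤-refl

  ∖-∧ : ∀ x y x' y' → (x ∧ y) ∖ (x' ∧ y') ≤ (x ∖ x') ∨ (y ∖ y')
  ∖-∧ x y x' y' = begin
    (x ∧ y) ∖ (x' ∧ y')                        ≈⟨ ∧-congˡ (deMorgan₁ x' y') ⟩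
    (x ∧ y) ∧ (¬ x' ∨ ¬ y')                    ≈⟨ ∧-distribˡ-∨ _ _ _ ⟩
    ((x ∧ y) ∖ x') ∨ ((x ∧ y) ∖ y')            ≤⟨ ∨-monotonic (∧-monotonic (x∧y≤x x y) ≤-refl)
                                                              (∧-monotonic (x∧y≤y x y) ≤-refl) ⟩
    (x ∖ x') ∨ (y ∖ y')                        ∎

  ∖-∨ : ∀ x y x' y' → (x ∨ y) ∖ (x' ∨ y') ≤ (x ∖ x') ∨ (y ∖ y')
  ∖-∨ x y x' y' = begin
    (x ∨ y) ∖ (x' ∨ y')                          ≈⟨ ∧-congˡ (deMorgan₂ x' y') ⟩
    (x ∨ y) ∧ (¬ x' ∧ ¬ y')                      ≈⟨ ∧-distribʳ-∨ _ _ _ ⟩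
    (x ∧ (¬ x' ∧ ¬ y')) ∨ (y ∧ (¬ x' ∧ ¬ y'))    ≤⟨ ∨-monotonic (∧-monotonic ≤-refl (x∧y≤x _ _))
                                                                (∧-monotonic ≤-refl (x∧y≤y _ _)) ⟩
    (x ∖ x') ∨ (y ∖ y')                          ∎

  ¬∖¬ : ∀ x y → (¬ x) ∖ (¬ y) ≈ y ∖ x
  ¬∖¬ x y = trans (∧-congˡ (¬-involutive y)) (∧-comm (¬ x) y)

  ∖≤-disjoint⇒∧≤ : ∀ {x y c d} → x ∖ y ≤ c → d ∧ c ≈ ⊥ → d ∧ x ≤ d ∧ y
  ∖≤-disjoint⇒∧≤ {x} {y} {c} {d} x∖y≤c d∧c≈⊥ = begin
    d ∧ x                          ≈⟨ ∧-∨-∖ (d ∧ x) y ⟩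
    ((d ∧ x) ∧ y) ∨ (d ∧ x) ∖ y    ≤⟨ ∨-monotonic (∧-monotonic (x∧y≤x d x) ≤-refl) outside-y ⟩
    (d ∧ y) ∨ ⊥                    ≈⟨ ∨-identityʳ (d ∧ y) ⟩
    d ∧ y                          ∎
    where
    outside-y : (d ∧ x) ∖ y ≤ ⊥
    outside-y = begin
      (d ∧ x) ∖ y   ≈⟨ ∧-assoc d x (¬ y) ⟩
      d ∧ x ∖ y     ≤⟨ ∧-monotonic ≤-refl x∖y≤c ⟩
      d ∧ c         ≈⟨ d∧c≈⊥ ⟩
      ⊥             ∎

  ∖≤-disjoint⇒∧≈ : ∀ {x y c d} → x ∖ y ≤ c → y ∖ x ≤ c → d ∧ c ≈ ⊥ → d ∧ x ≈ d ∧ y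
  ∖≤-disjoint⇒∧≈ x∖y≤c y∖x≤c d∧c≈⊥ =
    ≤-antisym (∖≤-disjoint⇒∧≤ x∖y≤c d∧c≈⊥) (∖≤-disjoint⇒∧≤ y∖x≤c d∧c≈⊥)

  ∨≈⊤⇒∧∨∧≈ : ∀ {a b} t → a ∨ b ≈ ⊤ → (a ∧ t) ∨ (b ∧ t) ≈ t
  ∨≈⊤⇒∧∨∧≈ {a} {b} t a∨b≈⊤ = begin-equality
    (a ∧ t) ∨ (b ∧ t)  ≈⟨ ∧-distribʳ-∨ t a b ⟨
    (a ∨ b) ∧ t        ≈⟨ ∧-congʳ a∨b≈⊤ ⟩
    ⊤ ∧ t              ≈⟨ ∧-identityˡ t ⟩
    t                  ∎

  ∨≈⊤⇒∧∨∧≈ˡ : ∀ {a b} u v → a ∨ b ≈ ⊤ → b ≈ ⊥ → (a ∧ u) ∨ (b ∧ v) ≈ u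
  ∨≈⊤⇒∧∨∧≈ˡ {a} {b} u v a∨b≈⊤ b≈⊥ = begin-equality
    (a ∧ u) ∨ (b ∧ v)  ≈⟨ ∨-cong (∧-congʳ a≈⊤) (∧-congʳ b≈⊥) ⟩
    (⊤ ∧ u) ∨ (⊥ ∧ v)  ≈⟨ ∨-cong (∧-identityˡ u) (∧-zeroˡ v) ⟩
    u ∨ ⊥              ≈⟨ ∨-identityʳ u ⟩
    u                  ∎
    where
    a≈⊤ : a ≈ ⊤
    a≈⊤ = trans (sym (∨-identityʳ a)) (trans (∨-congˡ (sym b≈⊥)) a∨b≈⊤)

  ∨≈⊤⇒∧∨∧≈ʳ : ∀ {a b} u v → a ∨ b ≈ ⊤ → a ≈ ⊥ → (a ∧ u) ∨ (b ∧ v) ≈ v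
  ∨≈⊤⇒∧∨∧≈ʳ {a} {b} u v a∨b≈⊤ a≈⊥ = begin-equality
    (a ∧ u) ∨ (b ∧ v)  ≈⟨ ∨-comm _ _ ⟩
    (b ∧ v) ∨ (a ∧ u)  ≈⟨ ∨≈⊤⇒∧∨∧≈ˡ v u (trans (∨-comm b a) a∨b≈⊤) a≈⊥ ⟩
    v                  ∎

module BAOProperties {S : Signature} (𝔅 : BAO S) where
  open BAO 𝔅 hiding (_≤_)
  open BooleanAlgebraProps boolAlg using (∧-idem; ∨-identityʳ; ¬⊤≈⊥)
  open BooleanAlgebraProperties boolAlg public
  open UpdateSetoid setoid
  open ≤-Reasoning poset

  -- Here ≤ is the library's x ≈ x ∧ y, whereas BAO._≤_ is x ∧ y ≈ x.
  ↓-closed : ∀ {g x y} → x ≤ y → Ig g y → Ig g x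
  ↓-closed x≤y = ↓-cl (sym x≤y)

  Ig-resp-≈ : ∀ {g x y} → x ≈ y → Ig g x → Ig g y
  Ig-resp-≈ x≈y = ↓-closed (≤-reflexive (sym x≈y))

  IgEqBl⇒Ig : ∀ {g b} → IgEqBl g b → Ig g b
  IgEqBl⇒Ig {b = b} Ig-g≡↓b = proj₂ (Ig-g≡↓b b) (∧-idem b)

  IgEqBl⇒≤ : ∀ {g b x} → IgEqBl g b → Ig g x → x ≤ b
  IgEqBl⇒≤ {x = x} Ig-g≡↓b x∈Ig = sym (proj₁ (Ig-g≡↓b x) x∈Ig)

  ops-mono : ∀ i v j {x y} → x ≤ y → ops i (v [ j ]≔ x) ≤ ops i (v [ j ]≔ y)
  ops-mono i v j {x} {y} x≤y = begin
    ops i (v [ j ]≔ x)                        ≤⟨ x≤x∨y _ _ ⟩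
    ops i (v [ j ]≔ x) ∨ ops i (v [ j ]≔ y)   ≈⟨ ops-additive i v j x y ⟨
    ops i (v [ j ]≔ (x ∨ y))                  ≈⟨ ops-cong i _ _ ([]≔-cong v j (x≤y⇒x∨y≈y x≤y)) ⟩
    ops i (v [ j ]≔ y)                        ∎

  ops-∖ : ∀ i v j x y → ops i (v [ j ]≔ x) ∖ ops i (v [ j ]≔ y) ≤ ops i (v [ j ]≔ (x ∖ y))
  ops-∖ i v j x y = x≤y∨z⇒x∖y≤z (begin
    ops i (v [ j ]≔ x)
      ≈⟨ ops-cong i _ _ ([]≔-cong v j (∧-∨-∖ x y)) ⟩
    ops i (v [ j ]≔ ((x ∧ y) ∨ x ∖ y))
      ≈⟨ ops-additive i v j _ _ ⟩
    ops i (v [ j ]≔ (x ∧ y)) ∨ ops i (v [ j ]≔ (x ∖ y))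
      ≤⟨ ∨-monotonic (ops-mono i v j (x∧y≤y x y)) ≤-refl ⟩
    ops i (v [ j ]≔ y) ∨ ops i (v [ j ]≔ (x ∖ y))
      ∎)

  Ig⊥⇒≈⊥ : ∀ {g x} → g ≈ ⊥ → Ig g x → x ≈ ⊥
  Ig⊥⇒≈⊥ g≈⊥ gen = g≈⊥
  Ig⊥⇒≈⊥ g≈⊥ zero = refl
  Ig⊥⇒≈⊥ g≈⊥ (∨-cl x∈Ig y∈Ig) = trans (∨-cong (Ig⊥⇒≈⊥ g≈⊥ x∈Ig) (Ig⊥⇒≈⊥ g≈⊥ y∈Ig)) (∨-identityʳ ⊥)
  Ig⊥⇒≈⊥ g≈⊥ (↓-cl x≤y y∈Ig) = ≤⊥⇒≈⊥ (≤-trans (sym x≤y) (≤-reflexive (Ig⊥⇒≈⊥ g≈⊥ y∈Ig)))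
  Ig⊥⇒≈⊥ g≈⊥ (ops-cl i v j vj∈Ig) = begin-equality
    ops i v              ≈⟨ ops-cong i _ _ ([]≔-self v j) ⟩
    ops i (v [ j ]≔ v j) ≈⟨ ops-cong i _ _ ([]≔-cong v j (Ig⊥⇒≈⊥ g≈⊥ vj∈Ig)) ⟩
    ops i (v [ j ]≔ ⊥)   ≈⟨ ops-normal i v j ⟩
    ⊥                    ∎

  infix 4 _≈[_]_
  _≈[_]_ : Carrier → Carrier → Carrier → Set
  x ≈[ g ] y = Ig g (x ∖ y) × Ig g (y ∖ x)

  ≈⇒≈[] : ∀ {g x y} → x ≈ y → x ≈[ g ] y
  ≈⇒≈[] {x = x} {y} x≈y =
    ↓-closed (≤-reflexive (trans (∧-congʳ x≈y) (∧-complementʳ y))) zero ,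
    ↓-closed (≤-reflexive (trans (∧-congʳ (sym x≈y)) (∧-complementʳ x))) zero

  ≈[]-trans : ∀ {g x y z} → x ≈[ g ] y → y ≈[ g ] z → x ≈[ g ] z
  ≈[]-trans {x = x} {y} {z} (x∖y∈Ig , y∖x∈Ig) (y∖z∈Ig , z∖y∈Ig) =
    ↓-closed (∖-triangle x y z) (∨-cl x∖y∈Ig y∖z∈Ig) ,
    ↓-closed (∖-triangle z y x) (∨-cl z∖y∈Ig y∖x∈Ig)

  ≈[]-preorder : Carrier → Preorder _ _ _
  ≈[]-preorder g = record
    { _≈_ = _≈_
    ; _≲_ = _≈[ g ]_
    ; isPreorder = record { isEquivalence = isEquivalence ; reflexive = ≈⇒≈[] ; trans = ≈[]-trans }
    }

  ∧-cong-≈[] : ∀ {g x x' y y'} → x ≈[ g ] x' → y ≈[ g ] y' → x ∧ y ≈[ g ] x' ∧ y'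
  ∧-cong-≈[] {x = x} {x'} {y} {y'} (p , p') (q , q') =
    ↓-closed (∖-∧ x y x' y') (∨-cl p q) , ↓-closed (∖-∧ x' y' x y) (∨-cl p' q')

  ∨-cong-≈[] : ∀ {g x x' y y'} → x ≈[ g ] x' → y ≈[ g ] y' → x ∨ y ≈[ g ] x' ∨ y'
  ∨-cong-≈[] {x = x} {x'} {y} {y'} (p , p') (q , q') =
    ↓-closed (∖-∨ x y x' y') (∨-cl p q) , ↓-closed (∖-∨ x' y' x y) (∨-cl p' q')

  ¬-cong-≈[] : ∀ {g x y} → x ≈[ g ] y → ¬ x ≈[ g ] ¬ y
  ¬-cong-≈[] {x = x} {y} (x∖y∈Ig , y∖x∈Ig) =
    Ig-resp-≈ (sym (¬∖¬ x y)) y∖x∈Ig , Ig-resp-≈ (sym (¬∖¬ y x)) x∖y∈Ig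

  ops-cong-≈[]ⱼ : ∀ {g} i v j {x y} → x ≈[ g ] y → ops i (v [ j ]≔ x) ≈[ g ] ops i (v [ j ]≔ y)
  ops-cong-≈[]ⱼ i v j {x} {y} (x∖y∈Ig , y∖x∈Ig) =
    ↓-closed (ops-∖ i v j x y) (ops-cl i _ j (Ig-resp-≈ (sym (updated _)) x∖y∈Ig)) ,
    ↓-closed (ops-∖ i v j y x) (ops-cl i _ j (Ig-resp-≈ (sym (updated _)) y∖x∈Ig))
    where
    updated : ∀ u → (v [ j ]≔ u) j ≈ u
    updated u = reflexive (updateAt-updates j v)

  ops-cong-≈[] : ∀ {g} i {v w} → (∀ j → v j ≈[ g ] w j) → ops i v ≈[ g ] ops i w
  ops-cong-≈[] {g} i = UpdatePreorder.coordinatewise⇒pointwise (≈[]-preorder g)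
    (ops i) (ops-cong i _ _) (ops-cong-≈[]ⱼ i)

  x≈[x]⊥ : ∀ {x} → x ≈[ x ] ⊥
  x≈[x]⊥ {x} = ↓-closed (x∧y≤x x (¬ ⊥)) gen , ↓-closed (x∧y≤x ⊥ (¬ x)) zero

  x≈[¬x]⊤ : ∀ {x} → x ≈[ ¬ x ] ⊤
  x≈[¬x]⊤ {x} =
    ↓-closed (≤-trans (x∧y≤y x (¬ ⊤)) (≤-reflexive ¬⊤≈⊥)) zero , ↓-closed (x∧y≤y ⊤ (¬ x)) gen

  ≈[]⇒∧≈-disjoint : ∀ {g b d x y} → IgEqBl g b → d ∧ b ≈ ⊥ → x ≈[ g ] y → d ∧ x ≈ d ∧ y
  ≈[]⇒∧≈-disjoint Ig-g≡↓b d∧b≈⊥ (x∖y∈Ig , y∖x∈Ig) =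
    ∖≤-disjoint⇒∧≈ (IgEqBl⇒≤ Ig-g≡↓b x∖y∈Ig) (IgEqBl⇒≤ Ig-g≡↓b y∖x∈Ig) d∧b≈⊥

module _ {S : Signature} where

  sub : ∀ {A C : Set} → (A → Term S C) → Term S A → Term S C
  sub σ (var x)    = σ x
  sub σ top        = top
  sub σ bot        = bot
  sub σ (meet s t) = meet (sub σ s) (sub σ t)
  sub σ (join s t) = join (sub σ s) (sub σ t)
  sub σ (neg s)    = neg (sub σ s)
  sub σ (op i ts)  = op i (λ j → sub σ (ts j))

  ren : ∀ {A C : Set} → (A → C) → Term S A → Term S C
  ren f = sub (var ∘ f)

  module _ (𝔅 : BAO S) where
    open BAO 𝔅

    eval-cong : ∀ {A : Set} {ρ ρ' : A → Carrier} → (∀ a → ρ a ≈ ρ' a) → ∀ t → eval ρ t ≈ eval ρ' t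
    eval-cong ρ≈ρ' (var x)    = ρ≈ρ' x
    eval-cong ρ≈ρ' top        = refl
    eval-cong ρ≈ρ' bot        = refl
    eval-cong ρ≈ρ' (meet s t) = ∧-cong (eval-cong ρ≈ρ' s) (eval-cong ρ≈ρ' t)
    eval-cong ρ≈ρ' (join s t) = ∨-cong (eval-cong ρ≈ρ' s) (eval-cong ρ≈ρ' t)
    eval-cong ρ≈ρ' (neg s)    = ¬-cong (eval-cong ρ≈ρ' s)
    eval-cong ρ≈ρ' (op i ts)  = ops-cong i _ _ (λ j → eval-cong ρ≈ρ' (ts j))

    eval-sub : ∀ {A C : Set} (ρ : C → Carrier) (σ : A → Term S C) t →
               eval ρ (sub σ t) ≈ eval (eval ρ ∘ σ) t
    eval-sub ρ σ (var x)    = refl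
    eval-sub ρ σ top        = refl
    eval-sub ρ σ bot        = refl
    eval-sub ρ σ (meet s t) = ∧-cong (eval-sub ρ σ s) (eval-sub ρ σ t)
    eval-sub ρ σ (join s t) = ∨-cong (eval-sub ρ σ s) (eval-sub ρ σ t)
    eval-sub ρ σ (neg s)    = ¬-cong (eval-sub ρ σ s)
    eval-sub ρ σ (op i ts)  = ops-cong i _ _ (λ j → eval-sub ρ σ (ts j))

    eval-ren : ∀ {A C : Set} (ρ : C → Carrier) (f : A → C) t → eval ρ (ren f t) ≈ eval (ρ ∘ f) t
    eval-ren ρ f = eval-sub ρ (var ∘ f)

-- Fr S E Y lives in Set₁, while the hypotheses speak about BAOs on Set; so the
-- free algebra is presented again on Set, as terms modulo derivable equality.
module TermAlgebra (S : Signature) (E : Equation S → Set) (Y : Set) where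
  open Signature S

  infix 4 _≐_
  data _≐_ : Term S Y → Term S Y → Set where
    ≐-refl        : ∀ {x} → x ≐ x
    ≐-sym         : ∀ {x y} → x ≐ y → y ≐ x
    ≐-trans       : ∀ {x y z} → x ≐ y → y ≐ z → x ≐ z
    ∨-comm        : ∀ x y → join x y ≐ join y x
    ∨-assoc       : ∀ x y z → join (join x y) z ≐ join x (join y z)
    ∨-cong        : ∀ {x y u v} → x ≐ y → u ≐ v → join x u ≐ join y v
    ∧-comm        : ∀ x y → meet x y ≐ meet y x
    ∧-assoc       : ∀ x y z → meet (meet x y) z ≐ meet x (meet y z)
    ∧-cong        : ∀ {x y u v} → x ≐ y → u ≐ v → meet x u ≐ meet y v
    ∨-absorbs-∧   : ∀ x y → join x (meet x y) ≐ x
    ∧-absorbs-∨   : ∀ x y → meet x (join x y) ≐ x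
    ∨-distribˡ-∧  : ∀ x y z → join x (meet y z) ≐ meet (join x y) (join x z)
    ∨-distribʳ-∧  : ∀ x y z → join (meet y z) x ≐ meet (join y x) (join z x)
    ∧-distribˡ-∨  : ∀ x y z → meet x (join y z) ≐ join (meet x y) (meet x z)
    ∧-distribʳ-∨  : ∀ x y z → meet (join y z) x ≐ join (meet y x) (meet z x)
    ∨-complementˡ : ∀ x → join (neg x) x ≐ top
    ∨-complementʳ : ∀ x → join x (neg x) ≐ top
    ∧-complementˡ : ∀ x → meet (neg x) x ≐ bot
    ∧-complementʳ : ∀ x → meet x (neg x) ≐ bot
    ¬-cong        : ∀ {x y} → x ≐ y → neg x ≐ neg y
    ops-cong      : ∀ i (v w : Fin (ar i) → Term S Y) → (∀ j → v j ≐ w j) → op i v ≐ op i w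
    ops-normal    : ∀ i (v : Fin (ar i) → Term S Y) j → op i (v [ j ]≔ bot) ≐ bot
    ops-additive  : ∀ i (v : Fin (ar i) → Term S Y) j x y →
                    op i (v [ j ]≔ join x y) ≐ join (op i (v [ j ]≔ x)) (op i (v [ j ]≔ y))
    axiom         : ∀ {s t} → E (s , t) → (σ : ℕ → Term S Y) → sub σ s ≐ sub σ t

  Syn : BAO S
  Syn = record
    { boolAlg = record
      { Carrier = Term S Y ; _≈_ = _≐_
      ; _∨_ = join ; _∧_ = meet ; ¬_ = neg ; ⊤ = top ; ⊥ = bot
      ; isBooleanAlgebra = record
        { isDistributiveLattice = record
          { isLattice = record
            { isEquivalence = record { refl = ≐-refl ; sym = ≐-sym ; trans = ≐-trans }
            ; ∨-comm = ∨-comm ; ∨-assoc = ∨-assoc ; ∨-cong = ∨-cong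
            ; ∧-comm = ∧-comm ; ∧-assoc = ∧-assoc ; ∧-cong = ∧-cong
            ; absorptive = ∨-absorbs-∧ , ∧-absorbs-∨
            }
          ; ∨-distrib-∧ = ∨-distribˡ-∧ , ∨-distribʳ-∧
          ; ∧-distrib-∨ = ∧-distribˡ-∨ , ∧-distribʳ-∨
          }
        ; ∨-complement = ∨-complementˡ , ∨-complementʳ
        ; ∧-complement = ∧-complementˡ , ∧-complementʳ
        ; ¬-cong = ¬-cong
        }
      }
    ; ops = op ; ops-cong = ops-cong ; ops-normal = ops-normal ; ops-additive = ops-additive
    }

  eval-Syn : ∀ {A : Set} (σ : A → Term S Y) t → BAO.eval Syn σ t ≐ sub σ t
  eval-Syn σ (var x)    = ≐-refl
  eval-Syn σ top        = ≐-refl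
  eval-Syn σ bot        = ≐-refl
  eval-Syn σ (meet s t) = ∧-cong (eval-Syn σ s) (eval-Syn σ t)
  eval-Syn σ (join s t) = ∨-cong (eval-Syn σ s) (eval-Syn σ t)
  eval-Syn σ (neg s)    = ¬-cong (eval-Syn σ s)
  eval-Syn σ (op i ts)  = ops-cong i _ _ (λ j → eval-Syn σ (ts j))

  Syn∈V : _∈V_ S Syn E
  Syn∈V s t s≡t∈E σ = ≐-trans (eval-Syn σ s) (≐-trans (axiom s≡t∈E σ) (≐-sym (eval-Syn σ t)))

  sub-sub : ∀ {A : Set} (σ : Y → Term S A) (τ : A → Term S Y) t →
            sub τ (sub σ t) ≐ sub (sub τ ∘ σ) t
  sub-sub σ τ (var x)    = ≐-refl
  sub-sub σ τ top        = ≐-refl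
  sub-sub σ τ bot        = ≐-refl
  sub-sub σ τ (meet s t) = ∧-cong (sub-sub σ τ s) (sub-sub σ τ t)
  sub-sub σ τ (join s t) = ∨-cong (sub-sub σ τ s) (sub-sub σ τ t)
  sub-sub σ τ (neg s)    = ¬-cong (sub-sub σ τ s)
  sub-sub σ τ (op i ts)  = ops-cong i _ _ (λ j → sub-sub σ τ (ts j))

  module _ {g : Term S Y} where
    open BAOProperties Syn
      using (_≈[_]_; ≈⇒≈[]; ∧-cong-≈[]; ∨-cong-≈[]; ¬-cong-≈[]; ops-cong-≈[])

    ≈[]-sub : (τ : Y → Term S Y) → (∀ y → var y ≈[ g ] τ y) → ∀ t → t ≈[ g ] sub τ t
    ≈[]-sub τ var≈τ (var y)    = var≈τ y
    ≈[]-sub τ var≈τ top        = ≈⇒≈[] ≐-refl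
    ≈[]-sub τ var≈τ bot        = ≈⇒≈[] ≐-refl
    ≈[]-sub τ var≈τ (meet s t) = ∧-cong-≈[] (≈[]-sub τ var≈τ s) (≈[]-sub τ var≈τ t)
    ≈[]-sub τ var≈τ (join s t) = ∨-cong-≈[] (≈[]-sub τ var≈τ s) (≈[]-sub τ var≈τ t)
    ≈[]-sub τ var≈τ (neg s)    = ¬-cong-≈[] (≈[]-sub τ var≈τ s)
    ≈[]-sub τ var≈τ (op i ts)  = ops-cong-≈[] i (λ j → ≈[]-sub τ var≈τ (ts j))

  module _ (𝔅 : BAO S) (𝔅∈V : _∈V_ S 𝔅 E) (ρ : Y → BAO.Carrier 𝔅) where
    private module 𝔅 = BAO 𝔅
    open 𝔅 using (_≈_; eval; refl; sym; trans; reflexive; setoid; Ig; gen; zero; ∨-cl; ↓-cl; ops-cl)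

    eval-[]≔ : ∀ {m} (v : Fin m → Term S Y) j u k →
               eval ρ ((v [ j ]≔ u) k) ≈ ((eval ρ ∘ v) [ j ]≔ eval ρ u) k
    eval-[]≔ v j u k = reflexive (map-updateAt-local {f = eval ρ} v j ≡.refl k)

    sound : ∀ {s t} → s ≐ t → eval ρ s ≈ eval ρ t
    sound ≐-refl = refl
    sound (≐-sym p) = sym (sound p)
    sound (≐-trans p q) = trans (sound p) (sound q)
    sound (∨-comm x y) = 𝔅.∨-comm _ _
    sound (∨-assoc x y z) = 𝔅.∨-assoc _ _ _
    sound (∨-cong p q) = 𝔅.∨-cong (sound p) (sound q)
    sound (∧-comm x y) = 𝔅.∧-comm _ _
    sound (∧-assoc x y z) = 𝔅.∧-assoc _ _ _
    sound (∧-cong p q) = 𝔅.∧-cong (sound p) (sound q)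
    sound (∨-absorbs-∧ x y) = 𝔅.∨-absorbs-∧ _ _
    sound (∧-absorbs-∨ x y) = 𝔅.∧-absorbs-∨ _ _
    sound (∨-distribˡ-∧ x y z) = 𝔅.∨-distribˡ-∧ _ _ _
    sound (∨-distribʳ-∧ x y z) = 𝔅.∨-distribʳ-∧ _ _ _
    sound (∧-distribˡ-∨ x y z) = 𝔅.∧-distribˡ-∨ _ _ _
    sound (∧-distribʳ-∨ x y z) = 𝔅.∧-distribʳ-∨ _ _ _
    sound (∨-complementˡ x) = 𝔅.∨-complementˡ _
    sound (∨-complementʳ x) = 𝔅.∨-complementʳ _
    sound (∧-complementˡ x) = 𝔅.∧-complementˡ _
    sound (∧-complementʳ x) = 𝔅.∧-complementʳ _
    sound (¬-cong p) = 𝔅.¬-cong (sound p)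
    sound (ops-cong i v w v≐w) = 𝔅.ops-cong i _ _ (λ j → sound (v≐w j))
    sound (ops-normal i v j) = trans (𝔅.ops-cong i _ _ (eval-[]≔ v j bot)) (𝔅.ops-normal i _ j)
    sound (ops-additive i v j x y) = begin
      𝔅.ops i (eval ρ ∘ (v [ j ]≔ join x y))
        ≈⟨ 𝔅.ops-cong i _ _ (eval-[]≔ v j (join x y)) ⟩
      𝔅.ops i (ρv [ j ]≔ (eval ρ x 𝔅.∨ eval ρ y))
        ≈⟨ 𝔅.ops-additive i ρv j _ _ ⟩
      𝔅.ops i (ρv [ j ]≔ eval ρ x) 𝔅.∨ 𝔅.ops i (ρv [ j ]≔ eval ρ y)
        ≈⟨ 𝔅.∨-cong (𝔅.ops-cong i _ _ (eval-[]≔ v j x)) (𝔅.ops-cong i _ _ (eval-[]≔ v j y)) ⟨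
      𝔅.ops i (eval ρ ∘ (v [ j ]≔ x)) 𝔅.∨ 𝔅.ops i (eval ρ ∘ (v [ j ]≔ y))
        ∎
      where
      open ≈-Reasoning setoid
      ρv : Fin (ar i) → 𝔅.Carrier
      ρv = eval ρ ∘ v
    sound (axiom {s} {t} s≡t∈E σ) = begin
      eval ρ (sub σ s)      ≈⟨ eval-sub 𝔅 ρ σ s ⟩
      eval (eval ρ ∘ σ) s   ≈⟨ 𝔅∈V s t s≡t∈E (eval ρ ∘ σ) ⟩
      eval (eval ρ ∘ σ) t   ≈⟨ eval-sub 𝔅 ρ σ t ⟨
      eval ρ (sub σ t)      ∎
      where open ≈-Reasoning setoid

    eval-Ig : ∀ {g t} → BAO.Ig Syn g t → Ig (eval ρ g) (eval ρ t)
    eval-Ig (BAO.gen) = gen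
    eval-Ig (BAO.zero) = zero
    eval-Ig (BAO.∨-cl x∈Ig y∈Ig) = ∨-cl (eval-Ig x∈Ig) (eval-Ig y∈Ig)
    eval-Ig (BAO.↓-cl x≤y y∈Ig) = ↓-cl (sound x≤y) (eval-Ig y∈Ig)
    eval-Ig (BAO.ops-cl i v j vj∈Ig) = ops-cl i _ j (eval-Ig vj∈Ig)

module _ {S : Signature} where
  open Signature S

  record IsCongruent {ℓ} (A : RawBAO S ℓ) : Set ℓ where
    open RawBAO A
    field
      isEquivalence : IsEquivalence _≈_
      ∧-cong   : ∀ {x x' y y'} → x ≈ x' → y ≈ y' → (x ∧ᵣ y) ≈ (x' ∧ᵣ y')
      ∨-cong   : ∀ {x x' y y'} → x ≈ x' → y ≈ y' → (x ∨ᵣ y) ≈ (x' ∨ᵣ y')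
      ¬-cong   : ∀ {x x'} → x ≈ x' → (¬ᵣ x) ≈ (¬ᵣ x')
      ops-cong : ∀ i {v w : Fin (ar i) → Carrier} → (∀ j → v j ≈ w j) → opsᵣ i v ≈ opsᵣ i w
    open IsEquivalence isEquivalence public

  record IsHomomorphism {ℓ} (A B : RawBAO S ℓ)
                        (h : RawBAO.Carrier A → RawBAO.Carrier B) : Set ℓ where
    private
      module A = RawBAO A
      module B = RawBAO B
    field
      cong     : ∀ {x y} → A._≈_ x y → B._≈_ (h x) (h y)
      ⊤-homo   : B._≈_ (h A.⊤ᵣ) B.⊤ᵣ
      ⊥-homo   : B._≈_ (h A.⊥ᵣ) B.⊥ᵣ
      ∧-homo   : ∀ x y → B._≈_ (h (A._∧ᵣ_ x y)) (B._∧ᵣ_ (h x) (h y))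
      ∨-homo   : ∀ x y → B._≈_ (h (A._∨ᵣ_ x y)) (B._∨ᵣ_ (h x) (h y))
      ¬-homo   : ∀ x → B._≈_ (h (A.¬ᵣ_ x)) (B.¬ᵣ_ (h x))
      ops-homo : ∀ i (v : Fin (ar i) → A.Carrier) → B._≈_ (h (A.opsᵣ i v)) (B.opsᵣ i (h ∘ v))

  mk≅ : ∀ {ℓ} {A B : RawBAO S ℓ} → IsCongruent A → IsCongruent B →
        (to : RawBAO.Carrier A → RawBAO.Carrier B) (from : RawBAO.Carrier B → RawBAO.Carrier A) →
        IsHomomorphism B A from →
        (∀ {x y} → RawBAO._≈_ A x y → RawBAO._≈_ B (to x) (to y)) →
        (∀ y → RawBAO._≈_ B (to (from y)) y) →
        (∀ x → RawBAO._≈_ A (from (to x)) x) →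
        _≅_ S A B
  mk≅ {A = A} {B} A-cong B-cong to from from-homo to-cong to-from from-to = record
    { to = to ; from = from ; to-cong = to-cong ; from-cong = cong
    ; to-from = to-from ; from-to = from-to
    ; to-⊤ = to-via-from (A.sym ⊤-homo)
    ; to-⊥ = to-via-from (A.sym ⊥-homo)
    ; to-∧ = λ x y → to-via-from (A.trans (A.∧-cong (A.sym (from-to x)) (A.sym (from-to y)))
                                           (A.sym (∧-homo (to x) (to y))))
    ; to-∨ = λ x y → to-via-from (A.trans (A.∨-cong (A.sym (from-to x)) (A.sym (from-to y)))
                                           (A.sym (∨-homo (to x) (to y))))
    ; to-¬ = λ x → to-via-from (A.trans (A.¬-cong (A.sym (from-to x))) (A.sym (¬-homo (to x))))
    ; to-ops = λ i v → to-via-from (A.trans (A.ops-cong i (λ j → A.sym (from-to (v j))))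
                                             (A.sym (ops-homo i (to ∘ v))))
    }
    where
    module A = IsCongruent A-cong
    module B = IsCongruent B-cong
    open IsHomomorphism from-homo

    to-via-from : ∀ {x y} → RawBAO._≈_ A x (from y) → RawBAO._≈_ B (to x) y
    to-via-from x≈from-y = B.trans (to-cong x≈from-y) (to-from _)

  ×ᴮ-isCongruent : ∀ {ℓ} {A B : RawBAO S ℓ} → IsCongruent A → IsCongruent B →
                   IsCongruent (_×ᴮ_ S A B)
  ×ᴮ-isCongruent A-cong B-cong = record
    { isEquivalence = record
      { refl  = A.refl , B.refl
      ; sym   = λ (p , q) → A.sym p , B.sym q
      ; trans = λ (p , q) (p' , q') → A.trans p p' , B.trans q q'
      }
    ; ∧-cong   = λ (p , q) (p' , q') → A.∧-cong p p' , B.∧-cong q q'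
    ; ∨-cong   = λ (p , q) (p' , q') → A.∨-cong p p' , B.∨-cong q q'
    ; ¬-cong   = λ (p , q) → A.¬-cong p , B.¬-cong q
    ; ops-cong = λ i v≈w → A.ops-cong i (proj₁ ∘ v≈w) , B.ops-cong i (proj₂ ∘ v≈w)
    }
    where
    module A = IsCongruent A-cong
    module B = IsCongruent B-cong

  module _ (E : Equation S → Set) where

    Fr-isCongruent : ∀ X → IsCongruent (Fr S E X)
    Fr-isCongruent X = record
      { isEquivalence = record
        { refl  = λ 𝔅 _ _ → BAO.refl 𝔅
        ; sym   = λ p 𝔅 𝔅∈V ρ → BAO.sym 𝔅 (p 𝔅 𝔅∈V ρ)
        ; trans = λ p q 𝔅 𝔅∈V ρ → BAO.trans 𝔅 (p 𝔅 𝔅∈V ρ) (q 𝔅 𝔅∈V ρ)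
        }
      ; ∧-cong   = λ p q 𝔅 𝔅∈V ρ → BAO.∧-cong 𝔅 (p 𝔅 𝔅∈V ρ) (q 𝔅 𝔅∈V ρ)
      ; ∨-cong   = λ p q 𝔅 𝔅∈V ρ → BAO.∨-cong 𝔅 (p 𝔅 𝔅∈V ρ) (q 𝔅 𝔅∈V ρ)
      ; ¬-cong   = λ p 𝔅 𝔅∈V ρ → BAO.¬-cong 𝔅 (p 𝔅 𝔅∈V ρ)
      ; ops-cong = λ i v≈w 𝔅 𝔅∈V ρ → BAO.ops-cong 𝔅 i _ _ (λ j → v≈w j 𝔅 𝔅∈V ρ)
      }

    Fr-sub-cong : ∀ {A C : Set} (σ : A → Term S C) {s t} → RawBAO._≈_ (Fr S E A) s t →
                  RawBAO._≈_ (Fr S E C) (lift (sub σ (lower s))) (lift (sub σ (lower t)))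
    Fr-sub-cong σ {s} {t} s≈t 𝔅 𝔅∈V ρ = begin
      eval ρ (sub σ (lower s))    ≈⟨ eval-sub 𝔅 ρ σ (lower s) ⟩
      eval (eval ρ ∘ σ) (lower s) ≈⟨ s≈t 𝔅 𝔅∈V (eval ρ ∘ σ) ⟩
      eval (eval ρ ∘ σ) (lower t) ≈⟨ eval-sub 𝔅 ρ σ (lower t) ⟨
      eval ρ (sub σ (lower t))    ∎
      where
      open BAO 𝔅 using (eval; setoid)
      open ≈-Reasoning setoid

module Splitting (S : Signature) (E : Equation S → Set) {X Y : Set} (X⊎𝟙↔Y : (X ⊎ Unit.⊤) ↔ Y) where
  open Inverse X⊎𝟙↔Y using (to; from; strictlyInverseˡ; strictlyInverseʳ)
  open TermAlgebra S E Y

  ι : X → Y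
  ι = to ∘ inj₁

  z : Y
  z = to (inj₂ Unit.tt)

  z≔_ : Term S X → Y → Term S X
  z≔ c = [ var , const c ]′ ∘ from

  z≔-ι : ∀ c x → (z≔ c) (ι x) ≡ var x
  z≔-ι c x = ≡.cong [ var , const c ]′ (strictlyInverseʳ (inj₁ x))

  z≔-z : ∀ c → (z≔ c) z ≡ c
  z≔-z c = ≡.cong [ var , const c ]′ (strictlyInverseʳ (inj₂ Unit.tt))

  module _ (𝔅 : BAO S) where
    open BAO 𝔅

    eval-z≔-ι : ∀ c (ρ : X → Carrier) x → eval ρ ((z≔ c) (ι x)) ≈ ρ x
    eval-z≔-ι c ρ x = reflexive (≡.cong (eval ρ) (z≔-ι c x))

    eval-z≔-z : ∀ c (ρ : X → Carrier) → eval ρ ((z≔ c) z) ≈ eval ρ c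
    eval-z≔-z c ρ = reflexive (≡.cong (eval ρ) (z≔-z c))

  open BAO Syn using (_≈_; _∧_; _∨_; ¬_; ⊤; ⊥; IgEqBl)
  open BAOProperties Syn
    using (_≈[_]_; ≈⇒≈[]; ≈[]-trans; x≈[x]⊥; x≈[¬x]⊤; ≈[]⇒∧≈-disjoint; ∨≈⊤⇒∧∨∧≈; IgEqBl⇒Ig)

  var≈[]ren-z≔ : ∀ {g} c → var z ≈[ g ] ren ι c → ∀ y → var y ≈[ g ] ren ι ((z≔ c) y)
  var≈[]ren-z≔ c z≈c y with from y | strictlyInverseˡ y
  ... | inj₁ x | ≡.refl = ≈⇒≈[] ≐-refl
  ... | inj₂ _ | ≡.refl = z≈c

  ≈[]-ren-sub-z≔ : ∀ {g} c → var z ≈[ g ] ren ι c → ∀ t → t ≈[ g ] ren ι (sub (z≔ c) t)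
  ≈[]-ren-sub-z≔ c z≈c t =
    ≈[]-trans (≈[]-sub _ (var≈[]ren-z≔ c z≈c) t) (≈⇒≈[] (≐-sym (sub-sub (z≔ c) (var ∘ ι) t)))

  module _ {b₀ b₁ : Term S Y} (Ig¬z≡↓b₀ : IgEqBl (¬ var z) b₀) (Igz≡↓b₁ : IgEqBl (var z) b₁)
           (b₀∧b₁≈⊥ : b₀ ∧ b₁ ≈ ⊥) (b₀∨b₁≈⊤ : b₀ ∨ b₁ ≈ ⊤) where

    glue : Term S X → Term S X → Term S Y
    glue s t = (b₀ ∧ ren ι s) ∨ (b₁ ∧ ren ι t)

    glue-sub-z≔ : ∀ t → glue (sub (z≔ bot) t) (sub (z≔ top) t) ≈ t
    glue-sub-z≔ t = begin
      glue (sub (z≔ bot) t) (sub (z≔ top) t)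
        ≈⟨ ∨-cong (≈[]⇒∧≈-disjoint Igz≡↓b₁ b₀∧b₁≈⊥ (≈[]-ren-sub-z≔ bot x≈[x]⊥ t))
                  (≈[]⇒∧≈-disjoint Ig¬z≡↓b₀ (≐-trans (∧-comm b₁ b₀) b₀∧b₁≈⊥)
                                   (≈[]-ren-sub-z≔ top x≈[¬x]⊤ t)) ⟨
      (b₀ ∧ t) ∨ (b₁ ∧ t)
        ≈⟨ ∨≈⊤⇒∧∨∧≈ t b₀∨b₁≈⊤ ⟩
      t ∎
      where open ≈-Reasoning (BAO.setoid Syn)

    module _ (𝔅 : BAO S) (𝔅∈V : _∈V_ S 𝔅 E) where
      private module 𝔅 = BAO 𝔅
      open 𝔅 using (Carrier; eval; setoid)
      open BAOProperties 𝔅 using (Ig⊥⇒≈⊥; ∨≈⊤⇒∧∨∧≈ˡ; ∨≈⊤⇒∧∨∧≈ʳ)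
      open BooleanAlgebraProps 𝔅.boolAlg using (¬⊤≈⊥)
      open ≈-Reasoning setoid

      eval-glue-z↦⊥ : ∀ {ρ : Y → Carrier} s t → ρ z 𝔅.≈ 𝔅.⊥ → eval ρ (glue s t) 𝔅.≈ eval (ρ ∘ ι) s
      eval-glue-z↦⊥ {ρ} s t ρz≈⊥ = 𝔅.trans
        (∨≈⊤⇒∧∨∧≈ˡ _ _ (sound 𝔅 𝔅∈V ρ b₀∨b₁≈⊤) (Ig⊥⇒≈⊥ ρz≈⊥ (eval-Ig 𝔅 𝔅∈V ρ (IgEqBl⇒Ig Igz≡↓b₁))))
        (eval-ren 𝔅 ρ ι s)

      eval-glue-z↦⊤ : ∀ {ρ : Y → Carrier} s t → ρ z 𝔅.≈ 𝔅.⊤ → eval ρ (glue s t) 𝔅.≈ eval (ρ ∘ ι) t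
      eval-glue-z↦⊤ {ρ} s t ρz≈⊤ = 𝔅.trans
        (∨≈⊤⇒∧∨∧≈ʳ _ _ (sound 𝔅 𝔅∈V ρ b₀∨b₁≈⊤)
          (Ig⊥⇒≈⊥ (𝔅.trans (𝔅.¬-cong ρz≈⊤) ¬⊤≈⊥) (eval-Ig 𝔅 𝔅∈V ρ (IgEqBl⇒Ig Ig¬z≡↓b₀))))
        (eval-ren 𝔅 ρ ι t)

      sub-z≔⊥-glue : ∀ (ρ : X → Carrier) s t → eval ρ (sub (z≔ bot) (glue s t)) 𝔅.≈ eval ρ s
      sub-z≔⊥-glue ρ s t = begin
        eval ρ (sub (z≔ bot) (glue s t))    ≈⟨ eval-sub 𝔅 ρ (z≔ bot) (glue s t) ⟩
        eval (eval ρ ∘ z≔ bot) (glue s t)   ≈⟨ eval-glue-z↦⊥ s t (eval-z≔-z 𝔅 bot ρ) ⟩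
        eval (eval ρ ∘ z≔ bot ∘ ι) s        ≈⟨ eval-cong 𝔅 (eval-z≔-ι 𝔅 bot ρ) s ⟩
        eval ρ s                            ∎

      sub-z≔⊤-glue : ∀ (ρ : X → Carrier) s t → eval ρ (sub (z≔ top) (glue s t)) 𝔅.≈ eval ρ t
      sub-z≔⊤-glue ρ s t = begin
        eval ρ (sub (z≔ top) (glue s t))    ≈⟨ eval-sub 𝔅 ρ (z≔ top) (glue s t) ⟩
        eval (eval ρ ∘ z≔ top) (glue s t)   ≈⟨ eval-glue-z↦⊤ s t (eval-z≔-z 𝔅 top ρ) ⟩
        eval (eval ρ ∘ z≔ top ∘ ι) t        ≈⟨ eval-cong 𝔅 (eval-z≔-ι 𝔅 top ρ) t ⟩
        eval ρ t                            ∎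

    to-pair : RawBAO.Carrier (_×ᴮ_ S (Fr S E X) (Fr S E X)) → RawBAO.Carrier (Fr S E Y)
    to-pair (s , t) = lift (glue (lower s) (lower t))

    from-pair : RawBAO.Carrier (Fr S E Y) → RawBAO.Carrier (_×ᴮ_ S (Fr S E X) (Fr S E X))
    from-pair q = lift (sub (z≔ bot) (lower q)) , lift (sub (z≔ top) (lower q))

    to-pair-cong : ∀ {p p'} → RawBAO._≈_ (_×ᴮ_ S (Fr S E X) (Fr S E X)) p p' →
                   RawBAO._≈_ (Fr S E Y) (to-pair p) (to-pair p')
    to-pair-cong {s , t} {s' , t'} (s≈s' , t≈t') 𝔅 𝔅∈V ρ =
      BAO.∨-cong 𝔅 (BAO.∧-congˡ 𝔅 (Fr-sub-cong E (var ∘ ι) {s} {s'} s≈s' 𝔅 𝔅∈V ρ))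
                   (BAO.∧-congˡ 𝔅 (Fr-sub-cong E (var ∘ ι) {t} {t'} t≈t' 𝔅 𝔅∈V ρ))

    from-pair-isHomomorphism : IsHomomorphism (Fr S E Y) (_×ᴮ_ S (Fr S E X) (Fr S E X)) from-pair
    from-pair-isHomomorphism = record
      { cong     = λ {q} {q'} q≈q' →
                     Fr-sub-cong E (z≔ bot) {q} {q'} q≈q' , Fr-sub-cong E (z≔ top) {q} {q'} q≈q'
      ; ⊤-homo   = (λ 𝔅 _ _ → BAO.refl 𝔅) , (λ 𝔅 _ _ → BAO.refl 𝔅)
      ; ⊥-homo   = (λ 𝔅 _ _ → BAO.refl 𝔅) , (λ 𝔅 _ _ → BAO.refl 𝔅)
      ; ∧-homo   = λ _ _ → (λ 𝔅 _ _ → BAO.refl 𝔅) , (λ 𝔅 _ _ → BAO.refl 𝔅)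
      ; ∨-homo   = λ _ _ → (λ 𝔅 _ _ → BAO.refl 𝔅) , (λ 𝔅 _ _ → BAO.refl 𝔅)
      ; ¬-homo   = λ _ → (λ 𝔅 _ _ → BAO.refl 𝔅) , (λ 𝔅 _ _ → BAO.refl 𝔅)
      ; ops-homo = λ _ _ → (λ 𝔅 _ _ → BAO.refl 𝔅) , (λ 𝔅 _ _ → BAO.refl 𝔅)
      }

    FrX×FrX≅FrY : _≅_ S (_×ᴮ_ S (Fr S E X) (Fr S E X)) (Fr S E Y)
    FrX×FrX≅FrY = mk≅
      (×ᴮ-isCongruent (Fr-isCongruent E X) (Fr-isCongruent E X)) (Fr-isCongruent E Y)
      to-pair from-pair from-pair-isHomomorphism (λ {p} {p'} → to-pair-cong {p} {p'})
      (λ q 𝔅 𝔅∈V ρ → sound 𝔅 𝔅∈V ρ (glue-sub-z≔ (lower q)))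
      (λ (s , t) → (λ 𝔅 𝔅∈V ρ → sub-z≔⊥-glue 𝔅 𝔅∈V ρ (lower s) (lower t)) ,
                   (λ 𝔅 𝔅∈V ρ → sub-z≔⊤-glue 𝔅 𝔅∈V ρ (lower s) (lower t)))

  HypII⇒FrX×FrX≅FrY : HypII S E → _≅_ S (_×ᴮ_ S (Fr S E X) (Fr S E X)) (Fr S E Y)
  HypII⇒FrX×FrX≅FrY hypII
    with hypII Syn Syn∈V (¬ var z) (var z) (∧-complementˡ (var z)) (∨-complementˡ (var z))
  ... | _ , _ , Ig¬z≡↓b₀ , Igz≡↓b₁ , b₀∧b₁≈⊥ , b₀∨b₁≈⊤ =
    FrX×FrX≅FrY Ig¬z≡↓b₀ Igz≡↓b₁ b₀∧b₁≈⊥ b₀∨b₁≈⊤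

-- Imported only here, since above ⊤ is the top element of the Boolean algebras.
open import Data.Unit using (⊤)

mainTheorem2 : (S : Signature) (E : Equation S → Set) →
    HypI S E → HypII S E →
    ((X : Set) → _≅_ S (_×ᴮ_ S (Fr S E X) (Fr S E X)) (Fr S E (X ⊎ ⊤)))
    × ((X : Set) → (X ⊎ ⊤) ↔ X → _≅_ S (_×ᴮ_ S (Fr S E X) (Fr S E X)) (Fr S E X))
mainTheorem2 S E _ hypII =
  (λ X → Splitting.HypII⇒FrX×FrX≅FrY S E (↔-id (X ⊎ ⊤)) hypII) ,
  (λ X X⊎⊤↔X → Splitting.HypII⇒FrX×FrX≅FrY S E X⊎⊤↔X hypII)
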